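{- Let $G$ be a $3$-rank-connected graph with $|V(G)|\ge 6$ and let $a,b$ be distinct vertices of $G$. Let $A$ be a quad of $G\setminus a$ and $B$ a quad of $G\setminus b$. If $|A\cap B|=1$, then $b\in A$ and $a\in B$.
   Context: Graphs are finite and simple; $G\setminus v$ is deletion. The cut-rank $\rho_G(X)$ is the $\mathrm{GF}(2)$-rank of the $X\times(V(G)-X)$ submatrix of the adjacency matrix. $G$ is $k$-rank-connected if there is no partition $(A,B)$ of $V(G)$ with $|A|,|B|>\rho_G(A)$ and $\rho_G(A)<k$. A quad of $G$ is a $4$-element $P\subseteq V(G)$ with $\rho_G(P)=2$ and $\rho_G(P-\{z\})=3$ for each $z\in P$. -}

module Defs where

open import Data.Nat using (ℕ; zero; suc; _≤_; _<_)
open import Data.Bool using (Bool; true; false; _∧_; _xor_; not)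
open import Data.Fin using (Fin; zero; suc)
open import Data.Fin.Subset using (Subset; _∈_; _⊆_; ∁; ⁅_⁆; _-_; ∣_∣; Nonempty; ⊤)
open import Data.Vec using (lookup)
open import Data.Product using (Σ; ∃; _×_)
open import Relation.Binary.PropositionalEquality using (_≡_)
open import Relation.Nullary using (¬_)

record Graph (n : ℕ) : Set where
  field
    adj    : Fin n → Fin n → Bool
    sym    : ∀ x y → adj x y ≡ adj y x
    irrefl : ∀ x → adj x x ≡ false
open Graph public

xorSum : ∀ {n} → (Fin n → Bool) → Bool
xorSum {zero}  f = false
xorSum {suc n} f = f zero xor xorSum (λ i → f (suc i))

-- We work with the induced subgraph G[W] (W ⊆ V(G)); G \ a is G[V - {a}].
-- Row of x in the X × (W - X) submatrix of the adjacency matrix of G[W]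
-- (as a vector indexed by Fin n, zero outside the column set W - X).
row : ∀ {n} → Graph n → Subset n → Subset n → Fin n → Fin n → Bool
row G W X x y = adj G x y ∧ (lookup W y ∧ not (lookup X y))

rowSum : ∀ {n} → Graph n → Subset n → Subset n → Subset n → Fin n → Bool
rowSum G W X T y = xorSum (λ i → lookup T i ∧ row G W X i y)

Independent : ∀ {n} → Graph n → Subset n → Subset n → Subset n → Set
Independent G W X S = ∀ T → T ⊆ S → Nonempty T → ∃ λ y → rowSum G W X T y ≡ true

-- CutRank G W X r : the cut-rank of X in G[W] (X ⊆ W) equals r, i.e. the
-- GF(2)-rank of the X × (W - X) submatrix is r (maximum number of
-- linearly independent rows).
CutRank : ∀ {n} → Graph n → Subset n → Subset n → ℕ → Set
CutRank G W X r =
  (∃ λ S → S ⊆ X × Independent G W X S × ∣ S ∣ ≡ r) ×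
  (∀ S → S ⊆ X → Independent G W X S → ∣ S ∣ ≤ r)

RankConnected : ∀ {n} → ℕ → Graph n → Set
RankConnected k G =
  ∀ A r → CutRank G ⊤ A r → r < k → ¬ (r < ∣ A ∣ × r < ∣ ∁ A ∣)

IsQuad : ∀ {n} → Graph n → Subset n → Subset n → Set
IsQuad G W P =
  P ⊆ W × ∣ P ∣ ≡ 4 × CutRank G W P 2 × (∀ z → z ∈ P → CutRank G W (P - z) 3)

IsQuadDel : ∀ {n} → Graph n → Fin n → Subset n → Set
IsQuadDel G a P = IsQuad G (∁ ⁅ a ⁆) P

{-# OPTIONS --safe #-}
module Submission where

-- Call a nonempty set T of rows of a quad P of G[W] a zero-sum if its rows add up to zero on
-- the cut of P, i.e. the GF(2) sum of the neighbourhoods of T vanishes on W - P. Since P has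
-- cut-rank 2, there is a zero-sum inside P - z for every z; since P - x has cut-rank 3, every
-- zero-sum inside P - x has x in its summed neighbourhood, and adding two zero-sums shows there
-- is one through x avoiding any given vertex of a zero-sum inside P - x.
-- Now let A ∩ B = {x} and suppose b ∉ A. Choosing suitably a zero-sum D of one quad avoiding x
-- and a zero-sum E of the other through x, with D and E each missing the vertex deleted for the
-- other quad, count the edges between D and E mod 2: from D's side every vertex lies outside the
-- other quad and contributes 0, from E's side exactly the vertex x contributes 1.

open import Defs hiding (sym)
open import Data.Nat using (zero; suc; _≤_; _<_; s≤s)
open import Data.Nat.Properties using (0≢1+n; ≤-trans; ≤-refl; n≤1+n; <⇒≱; ≤-pred; ≤-<-trans)
open import Data.Bool using (Bool; true; false; _∧_; _xor_; not)
open import Data.Bool.Properties as Bool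
  using (xor-∧-commutativeRing; ∧-commutativeMonoid; ∧-assoc; ¬-not)
open import Data.Fin using (Fin; zero; suc; punchIn)
open import Data.Fin.Properties using (any?; all?; punchInᵢ≢i) renaming (_≟_ to _≟ᶠ_)
open import Data.Fin.Subset
  using (Subset; _∈_; _∉_; _⊆_; _∩_; _─_; _-_; ∁; ⁅_⁆; ∣_∣; Nonempty; inside; outside)
open import Data.Fin.Subset.Properties
  using ( _∈?_; _⊆?_; nonempty?; anySubset?; Empty-unique; ∣⊥∣≡0; x∈⁅x⁆; x≢y⇒x∉⁅y⁆
        ; x∉p⇒x∈∁p; x∈p∩q⁺; x∈p∩q⁻; p─q⊆p; p─⊥≡p; x∈p∧x≢y⇒x∈p-y; x∈p⇒∣p-x∣<∣p∣
        ; p⊆q⇒∣p∣≤∣q∣; ⊆-trans )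
open import Data.Vec using (_∷_; lookup; zipWith; there)
open import Data.Vec.Properties using (lookup-zipWith; []=⇒lookup; lookup⇒[]=)
open import Data.Product using (∃; _×_; _,_; proj₁; proj₂)
open import Data.Empty using (⊥; ⊥-elim)
open import Algebra.Bundles using (CommutativeRing; CommutativeMonoid)
open import Algebra.Properties.Semiring.Sum (CommutativeRing.semiring xor-∧-commutativeRing)
  using (sum; sum-cong-≗; sum-replicate-zero; sum-remove; ∑-comm; ∑-distrib-+; *-distribˡ-sum; *-distribʳ-sum)
open import Algebra.Properties.CommutativeSemigroup
  (CommutativeMonoid.commutativeSemigroup ∧-commutativeMonoid) using (x∙yz≈y∙xz)
open import Relation.Binary.PropositionalEquality
  using (_≡_; _≢_; refl; sym; trans; cong; cong₂; subst; module ≡-Reasoning)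
open import Relation.Nullary using (¬_; yes; no; _×-dec_)
open import Relation.Nullary.Decidable using (decidable-stable)
open import Function using (_∘_)

true≢false : true ≢ false
true≢false ()

∉⇒lookup≡false : ∀ {n} {p : Subset n} {i} → i ∉ p → lookup p i ≡ false
∉⇒lookup≡false {p = p} {i} i∉p = ¬-not (i∉p ∘ lookup⇒[]= i p)

x∈p─q⇒x∉q : ∀ {n} (p q : Subset n) {x} → x ∈ p ─ q → x ∉ q
x∈p─q⇒x∉q (_ ∷ p) (outside ∷ q) (there x∈p─q) (there x∈q) = x∈p─q⇒x∉q p q x∈p─q x∈q
x∈p─q⇒x∉q (_ ∷ p) (inside  ∷ q) (there x∈p─q) (there x∈q) = x∈p─q⇒x∉q p q x∈p─q x∈q

x∈p-y⇒x≢y : ∀ {n} {p : Subset n} {x y} → x ∈ p - y → x ≢ y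
x∈p-y⇒x≢y {p = p} {y = y} x∈p-y refl = x∈p─q⇒x∉q p ⁅ y ⁆ x∈p-y (x∈⁅x⁆ y)

x∉p⇒p⊆∁⁅x⁆ : ∀ {n} {p : Subset n} {x} → x ∉ p → p ⊆ ∁ ⁅ x ⁆
x∉p⇒p⊆∁⁅x⁆ x∉p i∈p = x∉p⇒x∈∁p (x≢y⇒x∉⁅y⁆ λ { refl → x∉p i∈p })

p-x⊆∁⁅x⁆ : ∀ {n} {p : Subset n} {x} → p - x ⊆ ∁ ⁅ x ⁆
p-x⊆∁⁅x⁆ i∈p-x = x∉p⇒x∈∁p (x≢y⇒x∉⁅y⁆ (x∈p-y⇒x≢y i∈p-x))

∣p∣≤1+∣p-x∣ : ∀ {n} (p : Subset n) x → ∣ p ∣ ≤ suc ∣ p - x ∣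
∣p∣≤1+∣p-x∣ (inside  ∷ p) zero    = subst (λ q → suc ∣ p ∣ ≤ suc ∣ q ∣) (sym (p─⊥≡p p)) ≤-refl
∣p∣≤1+∣p-x∣ (outside ∷ p) zero    = subst (λ q → ∣ p ∣ ≤ suc ∣ q ∣) (sym (p─⊥≡p p)) (n≤1+n _)
∣p∣≤1+∣p-x∣ (inside  ∷ p) (suc x) = s≤s (∣p∣≤1+∣p-x∣ p x)
∣p∣≤1+∣p-x∣ (outside ∷ p) (suc x) = ∣p∣≤1+∣p-x∣ p x

∣p∣≡1⇒∃unique : ∀ {n} (p : Subset n) → ∣ p ∣ ≡ 1 → ∃ λ x → x ∈ p × ∀ y → y ∈ p → y ≡ x
∣p∣≡1⇒∃unique {n} p ∣p∣≡1 with nonempty? p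
... | no  p≡∅ = ⊥-elim (0≢1+n (trans (sym (∣⊥∣≡0 n)) (trans (cong ∣_∣ (sym (Empty-unique p≡∅))) ∣p∣≡1)))
... | yes (x , x∈p) = x , x∈p , λ y y∈p → decidable-stable (y ≟ᶠ x) λ y≢x →
  let y∈p-x = x∈p∧x≢y⇒x∈p-y y∈p y≢x in
  2+n≰1 (≤-trans (s≤s (x∈p⇒∣p-x∣<∣p∣ y∈p-x)) (subst (suc ∣ p - x ∣ ≤_) ∣p∣≡1 (x∈p⇒∣p-x∣<∣p∣ x∈p)))
  where
  2+n≰1 : ∀ {m} → ¬ (suc (suc m) ≤ 1)
  2+n≰1 (s≤s ())

infixl 6 _△_
_△_ : ∀ {n} → Subset n → Subset n → Subset n
p △ q = zipWith _xor_ p q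

lookup-△ : ∀ {n} (p q : Subset n) i → lookup (p △ q) i ≡ lookup p i xor lookup q i
lookup-△ p q i = lookup-zipWith _xor_ i p q

x∈p∧x∉q⇒x∈p△q : ∀ {n} {p q : Subset n} {x} → x ∈ p → x ∉ q → x ∈ p △ q
x∈p∧x∉q⇒x∈p△q {p = p} {q} {x} x∈p x∉q = lookup⇒[]= x (p △ q)
  (trans (lookup-△ p q x) (cong₂ _xor_ ([]=⇒lookup x∈p) (∉⇒lookup≡false x∉q)))

△-⊆ : ∀ {n} {p q r : Subset n} → p ⊆ r → q ⊆ r → p △ q ⊆ r
△-⊆ {p = p} {q} p⊆r q⊆r {i} i∈p△q with i ∈? p
... | yes i∈p = p⊆r i∈p
... | no  i∉p = q⊆r (lookup⇒[]= i q (begin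
  lookup q i                ≡⟨ cong (_xor lookup q i) (sym (∉⇒lookup≡false i∉p)) ⟩
  lookup p i xor lookup q i ≡⟨ sym (lookup-△ p q i) ⟩
  lookup (p △ q) i          ≡⟨ []=⇒lookup i∈p△q ⟩
  true                      ∎))
  where open ≡-Reasoning

xorSum≡sum : ∀ {n} (f : Fin n → Bool) → xorSum f ≡ sum f
xorSum≡sum {zero}  f = refl
xorSum≡sum {suc n} f = cong (f zero xor_) (xorSum≡sum (f ∘ suc))

sum-vanishing : ∀ {n} {f : Fin n → Bool} → (∀ i → f i ≡ false) → sum f ≡ false
sum-vanishing {n} f≡false = trans (sum-cong-≗ f≡false) (sum-replicate-zero n)

sum-single : ∀ {n} (f : Fin n → Bool) x → f x ≡ true → (∀ i → i ≢ x → f i ≡ false) →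
  sum f ≡ true
sum-single {suc n} f x fx≡true others≡false = begin
  sum f                       ≡⟨ sum-remove {i = x} f ⟩
  f x xor sum (f ∘ punchIn x) ≡⟨ cong₂ _xor_ fx≡true (sum-vanishing (λ j → others≡false _ (punchInᵢ≢i x j))) ⟩
  true                        ∎
  where open ≡-Reasoning

sumOver : ∀ {n} → Subset n → (Fin n → Bool) → Bool
sumOver p f = sum (λ i → lookup p i ∧ f i)

lookup∧≡false : ∀ {n} (p : Subset n) {i b} → (i ∈ p → b ≡ false) → lookup p i ∧ b ≡ false
lookup∧≡false p {i} b≡false with i ∈? p
... | yes i∈p rewrite []=⇒lookup i∈p = b≡false i∈p
... | no  i∉p rewrite ∉⇒lookup≡false i∉p = refl

sumOver-vanishing : ∀ {n} (p : Subset n) {f} → (∀ i → i ∈ p → f i ≡ false) →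
  sumOver p f ≡ false
sumOver-vanishing p f≡false = sum-vanishing λ i → lookup∧≡false p (f≡false i)

sumOver-single : ∀ {n} (p : Subset n) {f} {x} → x ∈ p → f x ≡ true →
  (∀ i → i ∈ p → i ≢ x → f i ≡ false) → sumOver p f ≡ true
sumOver-single p {x = x} x∈p fx≡true others≡false =
  sum-single _ x (cong₂ _∧_ ([]=⇒lookup x∈p) fx≡true)
    λ i i≢x → lookup∧≡false p (λ i∈p → others≡false i i∈p i≢x)

sumOver-△ : ∀ {n} (p q : Subset n) f → sumOver (p △ q) f ≡ sumOver p f xor sumOver q f
sumOver-△ p q f = begin
  sum (λ i → lookup (p △ q) i ∧ f i)
    ≡⟨ sum-cong-≗ (λ i → trans (cong (_∧ f i) (lookup-△ p q i))
                               (Bool.∧-distribʳ-xor (f i) (lookup p i) (lookup q i))) ⟩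
  sum (λ i → (lookup p i ∧ f i) xor (lookup q i ∧ f i))
    ≡⟨ ∑-distrib-+ (λ i → lookup p i ∧ f i) (λ i → lookup q i ∧ f i) ⟩
  sumOver p f xor sumOver q f ∎
  where open ≡-Reasoning

sumOver-∧ʳ : ∀ {n} (p : Subset n) f m → sumOver p (λ i → f i ∧ m) ≡ sumOver p f ∧ m
sumOver-∧ʳ p f m = trans (sum-cong-≗ (λ i → sym (∧-assoc (lookup p i) (f i) m)))
                         (sym (*-distribʳ-sum m (λ i → lookup p i ∧ f i)))

adjSum : ∀ {n} → Graph n → Subset n → Fin n → Bool
adjSum G T y = sumOver T (λ i → adj G i y)

adjSum-△ : ∀ {n} (G : Graph n) p q y → adjSum G (p △ q) y ≡ adjSum G p y xor adjSum G q y
adjSum-△ G p q y = sumOver-△ p q (λ i → adj G i y)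

adjSum-duality : ∀ {n} (G : Graph n) P Q → sumOver Q (adjSum G P) ≡ sumOver P (adjSum G Q)
adjSum-duality G P Q = begin
  sum (λ j → lookup Q j ∧ sum (λ i → lookup P i ∧ adj G i j))
    ≡⟨ sum-cong-≗ (λ j → *-distribˡ-sum (lookup Q j) (λ i → lookup P i ∧ adj G i j)) ⟩
  sum (λ j → sum (λ i → lookup Q j ∧ (lookup P i ∧ adj G i j)))
    ≡⟨ ∑-comm (λ j i → lookup Q j ∧ (lookup P i ∧ adj G i j)) ⟩
  sum (λ i → sum (λ j → lookup Q j ∧ (lookup P i ∧ adj G i j)))
    ≡⟨ sum-cong-≗ (λ i → sum-cong-≗ (λ j → swap-ends i j)) ⟩
  sum (λ i → sum (λ j → lookup P i ∧ (lookup Q j ∧ adj G j i)))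
    ≡⟨ sum-cong-≗ (λ i → sym (*-distribˡ-sum (lookup P i) (λ j → lookup Q j ∧ adj G j i))) ⟩
  sum (λ i → lookup P i ∧ sum (λ j → lookup Q j ∧ adj G j i)) ∎
  where
  open ≡-Reasoning
  swap-ends : ∀ i j → lookup Q j ∧ (lookup P i ∧ adj G i j) ≡ lookup P i ∧ (lookup Q j ∧ adj G j i)
  swap-ends i j = trans (x∙yz≈y∙xz (lookup Q j) (lookup P i) (adj G i j))
                        (cong (λ e → lookup P i ∧ (lookup Q j ∧ e)) (Graph.sym G i j))

rowSum≡sumOver : ∀ {n} (G : Graph n) W X T y →
  rowSum G W X T y ≡ sumOver T (λ i → row G W X i y)
rowSum≡sumOver G W X T y = xorSum≡sum (λ i → lookup T i ∧ row G W X i y)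

rowSum≡adjSum∧mask : ∀ {n} (G : Graph n) W X T y →
  rowSum G W X T y ≡ adjSum G T y ∧ (lookup W y ∧ not (lookup X y))
rowSum≡adjSum∧mask G W X T y =
  trans (rowSum≡sumOver G W X T y) (sumOver-∧ʳ T (λ i → adj G i y) (lookup W y ∧ not (lookup X y)))

rowSum-△ : ∀ {n} (G : Graph n) W X p q y →
  rowSum G W X (p △ q) y ≡ rowSum G W X p y xor rowSum G W X q y
rowSum-△ G W X p q y = begin
  rowSum G W X (p △ q) y                 ≡⟨ rowSum≡sumOver G W X (p △ q) y ⟩
  sumOver (p △ q) r                      ≡⟨ sumOver-△ p q r ⟩
  sumOver p r xor sumOver q r            ≡⟨ sym (cong₂ _xor_ (rowSum≡sumOver G W X p y) (rowSum≡sumOver G W X q y)) ⟩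
  rowSum G W X p y xor rowSum G W X q y  ∎
  where
  open ≡-Reasoning
  r = λ i → row G W X i y

∧-mask≡true : ∀ {a w x} → a ∧ (w ∧ not x) ≡ true → a ≡ true × w ≡ true × x ≡ false
∧-mask≡true {true} {true} {false} refl = refl , refl , refl

rowSum≡true⇒ : ∀ {n} (G : Graph n) W X T y → rowSum G W X T y ≡ true →
  adjSum G T y ≡ true × y ∈ W × y ∉ X
rowSum≡true⇒ G W X T y r≡true with ∧-mask≡true (trans (sym (rowSum≡adjSum∧mask G W X T y)) r≡true)
... | adj≡true , w≡true , x≡false =
  adj≡true , lookup⇒[]= y W w≡true , λ y∈X → true≢false (trans (sym ([]=⇒lookup y∈X)) x≡false)

ZeroSum : ∀ {n} → Graph n → Subset n → Subset n → Subset n → Set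
ZeroSum G W X T = ∀ y → rowSum G W X T y ≡ false

ZeroSum-△ : ∀ {n} (G : Graph n) W X p q → ZeroSum G W X p → ZeroSum G W X q →
  ZeroSum G W X (p △ q)
ZeroSum-△ G W X p q p≡0 q≡0 y =
  trans (rowSum-△ G W X p q y) (cong₂ _xor_ (p≡0 y) (q≡0 y))

ZeroSum⇒adjSum≡false : ∀ {n} (G : Graph n) W X T → ZeroSum G W X T →
  ∀ {y} → y ∈ W → y ∉ X → adjSum G T y ≡ false
ZeroSum⇒adjSum≡false G W X T T≡0 {y} y∈W y∉X = begin
  adjSum G T y                                    ≡⟨ sym (Bool.∧-identityʳ _) ⟩
  adjSum G T y ∧ true                             ≡⟨ cong (adjSum G T y ∧_) (sym y∈cut) ⟩
  adjSum G T y ∧ (lookup W y ∧ not (lookup X y))  ≡⟨ sym (rowSum≡adjSum∧mask G W X T y) ⟩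
  rowSum G W X T y                                ≡⟨ T≡0 y ⟩
  false                                           ∎
  where
  open ≡-Reasoning
  y∈cut : lookup W y ∧ not (lookup X y) ≡ true
  y∈cut rewrite []=⇒lookup y∈W | ∉⇒lookup≡false y∉X = refl

¬Independent⇒ZeroSum : ∀ {n} (G : Graph n) W X S → ¬ Independent G W X S →
  ∃ λ T → T ⊆ S × Nonempty T × ZeroSum G W X T
¬Independent⇒ZeroSum G W X S ¬indep =
  decidable-stable (anySubset? (λ T → T ⊆? S ×-dec nonempty? T ×-dec zeroSum? T))
    λ ¬zeroSum → ¬indep λ T T⊆S T≢∅ →
      decidable-stable (any? (λ y → rowSum G W X T y Bool.≟ true))
        λ ¬nonzero → ¬zeroSum (T , T⊆S , T≢∅ , λ y → ¬-not (λ r≡true → ¬nonzero (y , r≡true)))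
  where
  zeroSum? = λ T → all? (λ y → rowSum G W X T y Bool.≟ false)

rank<∣S∣⇒¬Independent : ∀ {n} (G : Graph n) W X S {r} → CutRank G W X r → S ⊆ X →
  r < ∣ S ∣ → ¬ Independent G W X S
rank<∣S∣⇒¬Independent G W X S (_ , maximal) S⊆X r<∣S∣ indep =
  <⇒≱ r<∣S∣ (maximal S S⊆X indep)

∣X∣≤rank⇒Independent : ∀ {n} (G : Graph n) W X {r} → CutRank G W X r → ∣ X ∣ ≤ r →
  Independent G W X X
∣X∣≤rank⇒Independent G W X ((S , S⊆X , indepS , ∣S∣≡r) , _) ∣X∣≤r T T⊆X =
  indepS T (X⊆S ∘ T⊆X)
  where
  X⊆S : X ⊆ S
  X⊆S {i} i∈X = decidable-stable (i ∈? S) λ i∉S →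
    <⇒≱ (≤-<-trans (p⊆q⇒∣p∣≤∣q∣ (S⊆X-i i∉S)) (x∈p⇒∣p-x∣<∣p∣ i∈X))
        (subst (∣ X ∣ ≤_) (sym ∣S∣≡r) ∣X∣≤r)
    where
    S⊆X-i : i ∉ S → S ⊆ X - i
    S⊆X-i i∉S j∈S = x∈p∧x≢y⇒x∈p-y (S⊆X j∈S) λ { refl → i∉S j∈S }

module Quad {n} (G : Graph n) (W P : Subset n) (quad : IsQuad G W P) where

  private
    ∣P∣≡4 : ∣ P ∣ ≡ 4
    ∣P∣≡4 = proj₁ (proj₂ quad)

    rank₂ : CutRank G W P 2
    rank₂ = proj₁ (proj₂ (proj₂ quad))

    rank₃ : ∀ z → z ∈ P → CutRank G W (P - z) 3
    rank₃ = proj₂ (proj₂ (proj₂ quad))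

    3≤∣P-z∣ : ∀ z → 3 ≤ ∣ P - z ∣
    3≤∣P-z∣ z = ≤-pred (subst (_≤ suc ∣ P - z ∣) ∣P∣≡4 (∣p∣≤1+∣p-x∣ P z))

    ∣P-x∣≤3 : ∀ {x} → x ∈ P → ∣ P - x ∣ ≤ 3
    ∣P-x∣≤3 x∈P = ≤-pred (subst (suc ∣ P - _ ∣ ≤_) ∣P∣≡4 (x∈p⇒∣p-x∣<∣p∣ x∈P))

  zeroSum-avoiding : ∀ z → ∃ λ T → T ⊆ P - z × Nonempty T × ZeroSum G W P T
  zeroSum-avoiding z = ¬Independent⇒ZeroSum G W P (P - z)
    (rank<∣S∣⇒¬Independent G W P (P - z) rank₂ (p─q⊆p P ⁅ z ⁆) (3≤∣P-z∣ z))

  -- The rows of P - x are independent in the cut of P - x, which is the cut of P plus the column x.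
  zeroSum-hits : ∀ {x T} → x ∈ P → T ⊆ P - x → Nonempty T → ZeroSum G W P T →
    adjSum G T x ≡ true
  zeroSum-hits {x} {T} x∈P T⊆P-x T≢∅ T≡0
    with ∣X∣≤rank⇒Independent G W (P - x) (rank₃ x x∈P) (∣P-x∣≤3 x∈P) T T⊆P-x T≢∅
  ... | y , r≡true with rowSum≡true⇒ G W (P - x) T y r≡true | y ≟ᶠ x
  ...   | adj≡true , _   , _     | yes refl = adj≡true
  ...   | adj≡true , y∈W , y∉P-x | no  y≢x  = ⊥-elim (true≢false (trans (sym adj≡true)
          (ZeroSum⇒adjSum≡false G W P T T≡0 y∈W (λ y∈P → y∉P-x (x∈p∧x≢y⇒x∈p-y y∈P y≢x)))))

  zeroSum-through : ∀ {x z T} → x ∈ P → T ⊆ P - x → ZeroSum G W P T → z ∈ T →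
    ∃ λ E → E ⊆ P - z × x ∈ E × ZeroSum G W P E
  zeroSum-through {x} {z} {T} x∈P T⊆P-x T≡0 z∈T with zeroSum-avoiding z
  ... | E , E⊆P-z , E≢∅ , E≡0 with x ∈? E
  ...   | yes x∈E = E , E⊆P-z , x∈E , E≡0
  ...   | no  x∉E = ⊥-elim (true≢false (begin
    true                                  ≡⟨ sym (zeroSum-hits x∈P (△-⊆ T⊆P-x E⊆P-x) T△E≢∅ (ZeroSum-△ G W P T E T≡0 E≡0)) ⟩
    adjSum G (T △ E) x                    ≡⟨ adjSum-△ G T E x ⟩
    adjSum G T x xor adjSum G E x         ≡⟨ cong₂ _xor_ (zeroSum-hits x∈P T⊆P-x (z , z∈T) T≡0)
                                                         (zeroSum-hits x∈P E⊆P-x E≢∅ E≡0) ⟩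
    false                                 ∎))
    where
    open ≡-Reasoning
    E⊆P-x : E ⊆ P - x
    E⊆P-x i∈E = x∈p∧x≢y⇒x∈p-y (p─q⊆p P ⁅ z ⁆ (E⊆P-z i∈E)) λ { refl → x∉E i∈E }
    T△E≢∅ : Nonempty (T △ E)
    T△E≢∅ = z , x∈p∧x∉q⇒x∈p△q z∈T (λ z∈E → x∈p-y⇒x≢y (E⊆P-z z∈E) refl)

-- Count the edges between E and D mod 2 from both sides: seen from D the sum vanishes,
-- seen from E only the vertex x contributes.
zeroSums-cannot-cross : ∀ {n} (G : Graph n) {V W P Q : Subset n} {x D E} →
  IsQuad G V Q → x ∈ Q → D ⊆ Q - x → Nonempty D → ZeroSum G V Q D → D ⊆ W →
  E ⊆ P → x ∈ E → ZeroSum G W P E → E ⊆ V →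
  (∀ y → y ∈ P → y ∈ Q → y ≡ x) → ⊥
zeroSums-cannot-cross G {V} {W} {P} {Q} {x} {D} {E}
  quadQ x∈Q D⊆Q-x D≢∅ D≡0 D⊆W E⊆P x∈E E≡0 E⊆V P∩Q⊆x = true≢false (begin
    true                    ≡⟨ sym (sumOver-single E x∈E (Quad.zeroSum-hits G V Q quadQ x∈Q D⊆Q-x D≢∅ D≡0) off-x) ⟩
    sumOver E (adjSum G D)  ≡⟨ adjSum-duality G D E ⟩
    sumOver D (adjSum G E)  ≡⟨ sumOver-vanishing D on-D ⟩
    false                   ∎)
  where
  open ≡-Reasoning
  off-x : ∀ i → i ∈ E → i ≢ x → adjSum G D i ≡ false
  off-x i i∈E i≢x = ZeroSum⇒adjSum≡false G V Q D D≡0 (E⊆V i∈E) λ i∈Q → i≢x (P∩Q⊆x i (E⊆P i∈E) i∈Q)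
  on-D : ∀ j → j ∈ D → adjSum G E j ≡ false
  on-D j j∈D = ZeroSum⇒adjSum≡false G W P E E≡0 (D⊆W j∈D) λ j∈P →
    x∈p-y⇒x≢y (D⊆Q-x j∈D) (P∩Q⊆x j j∈P (p─q⊆p Q ⁅ x ⁆ (D⊆Q-x j∈D)))

deleted-vertex∈other-quad : ∀ {n} (G : Graph n) {a b A B x} →
  IsQuadDel G a A → IsQuadDel G b B → x ∈ A → x ∈ B → (∀ y → y ∈ A → y ∈ B → y ≡ x) →
  b ∈ A
deleted-vertex∈other-quad G {a} {b} {A} {B} {x} quadA quadB x∈A x∈B A∩B⊆x =
  decidable-stable (b ∈? A) b∉A⇒⊥
  where
  module QA = Quad G (∁ ⁅ a ⁆) A quadA
  module QB = Quad G (∁ ⁅ b ⁆) B quadB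
  b∉A⇒⊥ : b ∉ A → ⊥
  b∉A⇒⊥ b∉A with QA.zeroSum-avoiding x | QB.zeroSum-avoiding x
  ... | T , T⊆A-x , (z , z∈T) , T≡0 | S , S⊆B-x , S≢∅ , S≡0 with a ∈? S
  ... | yes a∈S with QB.zeroSum-through x∈B S⊆B-x S≡0 a∈S
  ...   | E , E⊆B-a , x∈E , E≡0 =
    zeroSums-cannot-cross G quadA x∈A T⊆A-x (z , z∈T) T≡0
      (⊆-trans (⊆-trans T⊆A-x (p─q⊆p A ⁅ x ⁆)) (x∉p⇒p⊆∁⁅x⁆ b∉A))
      (⊆-trans E⊆B-a (p─q⊆p B ⁅ a ⁆)) x∈E E≡0 (⊆-trans E⊆B-a p-x⊆∁⁅x⁆)
      (λ y y∈B y∈A → A∩B⊆x y y∈A y∈B)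
  b∉A⇒⊥ b∉A | T , T⊆A-x , (z , z∈T) , T≡0 | S , S⊆B-x , S≢∅ , S≡0 | no a∉S
    with QA.zeroSum-through x∈A T⊆A-x T≡0 z∈T
  ... | E , E⊆A-z , x∈E , E≡0 =
    zeroSums-cannot-cross G quadB x∈B S⊆B-x S≢∅ S≡0 (x∉p⇒p⊆∁⁅x⁆ a∉S)
      E⊆A x∈E E≡0 (⊆-trans E⊆A (x∉p⇒p⊆∁⁅x⁆ b∉A)) A∩B⊆x
    where
    E⊆A : E ⊆ A
    E⊆A = ⊆-trans E⊆A-z (p─q⊆p A ⁅ z ⁆)

lemma4p14 : ∀ {n} (G : Graph n) → RankConnected 3 G → 6 ≤ n →
    (a b : Fin n) → ¬ (a ≡ b) → (A B : Subset n) →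
    IsQuadDel G a A → IsQuadDel G b B → ∣ A ∩ B ∣ ≡ 1 →
    b ∈ A × a ∈ B
lemma4p14 G _ _ a b _ A B quadA quadB ∣A∩B∣≡1 with ∣p∣≡1⇒∃unique (A ∩ B) ∣A∩B∣≡1
... | x , x∈A∩B , unique with x∈p∩q⁻ A B x∈A∩B
... | x∈A , x∈B =
  deleted-vertex∈other-quad G quadA quadB x∈A x∈B (λ y y∈A y∈B → unique y (x∈p∩q⁺ (y∈A , y∈B))) ,
  deleted-vertex∈other-quad G quadB quadA x∈B x∈A (λ y y∈B y∈A → unique y (x∈p∩q⁺ (y∈A , y∈B)))
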